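{- Let $\mathbb{Q}$ be a forcing poset with greatest lower bounds. Let $N$ be a set and $q\in\mathbb{Q}$. If $q$ is a strongly $(N,\mathbb{Q})$-generic condition, then $q$ is a simple strongly $(N,\mathbb{Q})$-generic condition.
   Context: A forcing poset has greatest lower bounds if any two compatible conditions $p,q$ have a greatest lower bound $p\wedge q$. $q\in\mathbb{Q}$ is strongly $(N,\mathbb{Q})$-generic if every set dense in the poset $N\cap\mathbb{Q}$ (induced order) is predense in $\mathbb{Q}$ below $q$. $q$ is a simple strongly $(N,\mathbb{Q})$-generic condition if there exist a set $E\subseteq\mathbb{Q}$ dense below $q$ and a function $r\mapsto r\restriction N$ defined on $E$ such that for all $r\in E$: $r\restriction N\in N\cap\mathbb{Q}$, $r\leq r\restriction N$, and every $v\leq r\restriction N$ with $v\in N\cap\mathbb{Q}$ is compatible with $r$. -}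

module Defs where

open import Level using (Level; suc; _⊔_)
open import Data.Product using (Σ; Σ-syntax; _×_; _,_)
open import Relation.Nullary using (Dec)

record ForcingPoset : Set₁ where
  field
    Carrier  : Set
    _≤_      : Carrier → Carrier → Set
    ≤-refl   : ∀ {p} → p ≤ p
    ≤-trans  : ∀ {p q r} → p ≤ q → q ≤ r → p ≤ r
    𝟙        : Carrier
    ≤-𝟙      : ∀ {p} → p ≤ 𝟙

module _ (ℚ : ForcingPoset) where
  open ForcingPoset ℚ

  Compatible : Carrier → Carrier → Set
  Compatible p q = Σ[ r ∈ Carrier ] (r ≤ p × r ≤ q)

  IsGLB : Carrier → Carrier → Carrier → Set
  IsGLB p q m = m ≤ p × m ≤ q × (∀ r → r ≤ p → r ≤ q → r ≤ m)

  HasGLBs : Set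
  HasGLBs = ∀ p q → Compatible p q → Σ[ m ∈ Carrier ] IsGLB p q m

  -- D is a dense subset of the poset N ∩ ℚ (with induced order);
  -- N is a set, represented by its membership predicate on ℚ.
  DenseInN : (N : Carrier → Set) → (D : Carrier → Set) → Set
  DenseInN N D =
    (∀ d → D d → N d) ×
    (∀ p → N p → Σ[ d ∈ Carrier ] (D d × d ≤ p))

  PredenseBelow : (D : Carrier → Set) → Carrier → Set
  PredenseBelow D q =
    ∀ r → r ≤ q → Σ[ d ∈ Carrier ] (D d × Compatible d r)

  DenseBelow : (E : Carrier → Set) → Carrier → Set
  DenseBelow E q = ∀ p → p ≤ q → Σ[ r ∈ Carrier ] (E r × r ≤ p)

  StronglyGeneric : (N : Carrier → Set) → Carrier → Set₁
  StronglyGeneric N q =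
    ∀ (D : Carrier → Set) → DenseInN N D → PredenseBelow D q

  SimpleStronglyGeneric : (N : Carrier → Set) → Carrier → Set₁
  SimpleStronglyGeneric N q =
    Σ[ E ∈ (Carrier → Set) ] (DenseBelow E q ×
      Σ[ restr ∈ ((r : Carrier) → E r → Carrier) ]
        (∀ r (e : E r) →
            N (restr r e) ×
            r ≤ restr r e ×
            (∀ v → N v → v ≤ restr r e → Compatible v r)))

-- The law of excluded middle (the paper's ambient logic is classical).
ExcludedMiddle : Set₁
ExcludedMiddle = (P : Set) → Dec P

module Submission where

-- Call s ∈ N a *restriction* of r to N if r ≤ s and every v ∈ N with
-- v ≤ s is compatible with r.  A condition q is simple strongly generic
-- as soon as the conditions having a restriction are dense below q; the
-- restriction map is then read off from the witnesses.
--
-- To find such conditions below a given p ≤ q, consider the conditions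
-- of N that *decide* p: either all their N-extensions are compatible
-- with p, or they are themselves incompatible with p.  Classically these
-- deciders are dense in N, so by strong genericity some decider d is
-- compatible with p; being compatible, d falls in the first case.  Then
-- the greatest lower bound d ∧ p lies below p and has d as a restriction,
-- because any common extension of v and p with v ≤ d is below d ∧ p.

open import Defs
open import Data.Product using (Σ; Σ-syntax; _×_; _,_; proj₁; proj₂)
open import Data.Sum using (_⊎_; inj₁; inj₂)
open import Data.Empty using (⊥-elim)
open import Relation.Nullary using (yes; no; ¬_)

module _ (ℚ : ForcingPoset) (N : ForcingPoset.Carrier ℚ → Set) where
  open ForcingPoset ℚ

  IsRestriction : Carrier → Carrier → Set
  IsRestriction r s =
    N s × r ≤ s × (∀ v → N v → v ≤ s → Compatible ℚ v r)

  Restrictable : Carrier → Set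
  Restrictable r = Σ[ s ∈ Carrier ] IsRestriction r s

  simple-of-restrictable-dense : ∀ q →
    DenseBelow ℚ Restrictable q → SimpleStronglyGeneric ℚ N q
  simple-of-restrictable-dense q dense =
    Restrictable , dense , (λ r e → proj₁ e) , (λ r e → proj₂ e)

  AllCompatibleBelow : Carrier → Carrier → Set
  AllCompatibleBelow s p = ∀ v → N v → v ≤ s → Compatible ℚ v p

  Decides : Carrier → Carrier → Set
  Decides p s = N s × (AllCompatibleBelow s p ⊎ ¬ Compatible ℚ s p)

  -- Classically, the deciders of any p are dense in N: below t ∈ N,
  -- either some v ∈ N is incompatible with p, or t itself decides p.
  deciders-dense : ExcludedMiddle → ∀ p → DenseInN ℚ N (Decides p)
  deciders-dense lem p = (λ s Ds → proj₁ Ds) , decider-below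
    where
    decider-below : ∀ t → N t → Σ[ d ∈ Carrier ] (Decides p d × d ≤ t)
    decider-below t Nt
      with lem (Σ[ v ∈ Carrier ] (N v × v ≤ t × ¬ Compatible ℚ v p))
    ... | yes (v , Nv , v≤t , v⊥p) = v , (Nv , inj₂ v⊥p) , v≤t
    ... | no none = t , (Nt , inj₁ all-compatible) , ≤-refl
      where
      all-compatible : AllCompatibleBelow t p
      all-compatible v Nv v≤t with lem (Compatible ℚ v p)
      ... | yes v∥p = v∥p
      ... | no v⊥p = ⊥-elim (none (v , Nv , v≤t , v⊥p))

  compatible-decider : ∀ {p d} →
    Decides p d → Compatible ℚ d p → AllCompatibleBelow d p
  compatible-decider (_ , inj₁ all-compatible) _ = all-compatible
  compatible-decider (_ , inj₂ d⊥p) d∥p = ⊥-elim (d⊥p d∥p)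

  -- If m = d ∧ p, then compatibility with p of the N-extensions of d
  -- upgrades to compatibility with m: a common extension w of v ≤ d and
  -- p lies below both d and p, hence below m.
  compatible-with-glb : ∀ {d p m} → IsGLB ℚ d p m →
    AllCompatibleBelow d p → AllCompatibleBelow d m
  compatible-with-glb (_ , _ , greatest) all-compatible v Nv v≤d
    with all-compatible v Nv v≤d
  ... | w , w≤v , w≤p = w , w≤v , greatest w (≤-trans w≤v v≤d) w≤p

  -- The key step: under strong genericity of q, every p ≤ q extends to
  -- the restrictable condition d ∧ p, where d is a decider meeting p.
  restrictable-dense : ExcludedMiddle → HasGLBs ℚ → ∀ q →
    StronglyGeneric ℚ N q → DenseBelow ℚ Restrictable q
  restrictable-dense lem glb q sg p p≤q
    with sg (Decides p) (deciders-dense lem p) p p≤q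
  ... | d , Dd , d∥p with glb d p d∥p
  ... | m , m-glb@(m≤d , m≤p , _) =
    m , (d , proj₁ Dd , m≤d ,
         compatible-with-glb m-glb (compatible-decider Dd d∥p)) , m≤p

lemma2p5 : ExcludedMiddle → (ℚ : ForcingPoset) → HasGLBs ℚ →
    (N : ForcingPoset.Carrier ℚ → Set) → (q : ForcingPoset.Carrier ℚ) →
    StronglyGeneric ℚ N q → SimpleStronglyGeneric ℚ N q
lemma2p5 lem ℚ glb N q sg =
  simple-of-restrictable-dense ℚ N q (restrictable-dense ℚ N lem glb q sg)
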